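{- There exist absolute constants $c>0$ and $\varepsilon_0>0$ such that for every integer $m\ge 1$ and every $0<\varepsilon<\varepsilon_0$, every one-sided $\varepsilon$-test for $\mathcal{S}_m$ in the standard model of distribution testing, over a domain with at least $2m+1$ elements, takes at least $c\,\varepsilon^{ -1}m$ samples (in the worst case).
   Context: Standard model of distribution testing: the input is an unknown distribution $\mu$ over a finite domain $\Omega$, and the algorithm receives independent samples from $\mu$ (fully observed); its complexity is the number of samples. The distance is the variation distance $d(\mu,\nu)=\frac12\sum_{u\in\Omega}|\mu(u)-\nu(u)|$. $\mathcal{S}_m$ is the set of distributions supported on at most $m$ elements; $\mu$ is $\varepsilon$-far from $\mathcal{S}_m$ if $\min_{\nu\in\mathcal{S}_m}d(\mu,\nu)>\varepsilon$. A one-sided $\varepsilon$-test accepts every $\mu\in\mathcal{S}_m$ with probability $1$ and rejects every $\mu$ that is $\varepsilon$-far from $\mathcal{S}_m$ with probability greater than $2/3$.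
   Formalization: The parameter ε is rational, and each one-sided ε-test accepts with a rational probability after every sequence of samples. -}

module Defs where

open import Data.Nat as ℕ using (ℕ; zero; suc)
open import Data.Integer using (+_)
open import Data.Fin using (Fin)
open import Data.Vec using (Vec; []; _∷_)
import Data.Vec as Vec
open import Data.List using (List; []; _∷_; [_]; map; concatMap; allFin; filter; length; foldr)
open import Data.Rational using (ℚ; 0ℚ; 1ℚ; ½; _+_; _*_; _-_; ∣_∣; _≤_; _<_; _/_)
open import Data.Rational.Properties using (_≟_)
open import Data.Product using (_×_)
open import Relation.Nullary using (¬?)

ℕ→ℚ : ℕ → ℚ
ℕ→ℚ k = + k / 1

sumL : {A : Set} → List A → (A → ℚ) → ℚ
sumL xs f = foldr (λ x acc → f x + acc) 0ℚ xs

sumΩ : (n : ℕ) → (Fin n → ℚ) → ℚ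
sumΩ n f = sumL (allFin n) f

IsDistribution : (n : ℕ) → (Fin n → ℚ) → Set
IsDistribution n μ = (∀ u → 0ℚ ≤ μ u) × sumΩ n μ ≡ 1ℚ
  where open import Relation.Binary.PropositionalEquality using (_≡_)

supportSize : (n : ℕ) → (Fin n → ℚ) → ℕ
supportSize n μ = length (filter (λ u → ¬? (μ u ≟ 0ℚ)) (allFin n))

InS : (m n : ℕ) → (Fin n → ℚ) → Set
InS m n μ = IsDistribution n μ × supportSize n μ ℕ.≤ m

dist : (n : ℕ) → (Fin n → ℚ) → (Fin n → ℚ) → ℚ
dist n μ ν = ½ * sumΩ n (λ u → ∣ μ u - ν u ∣)

-- μ is ε-far from S_m : distance to every ν ∈ S_m exceeds ε
-- (the minimum in the paper is attained, so this is the same as min > ε)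
FarFromS : (m n : ℕ) → ℚ → (Fin n → ℚ) → Set
FarFromS m n ε μ = ∀ ν → InS m n ν → ε < dist n μ ν

allSeqs : (n q : ℕ) → List (Vec (Fin n) q)
allSeqs n zero = [ [] ]
allSeqs n (suc q) = concatMap (λ x → map (x ∷_) (allSeqs n q)) (allFin n)

seqProb : {n q : ℕ} → (Fin n → ℚ) → Vec (Fin n) q → ℚ
seqProb μ xs = Vec.foldr _ (λ x acc → μ x * acc) 1ℚ xs

-- A (possibly randomized) algorithm taking q samples is described by the
-- probability T x ∈ [0,1] that it accepts after seeing the samples x.
IsTestFn : (n q : ℕ) → (Vec (Fin n) q → ℚ) → Set
IsTestFn n q T = ∀ x → (0ℚ ≤ T x) × (T x ≤ 1ℚ)

accProb : (n q : ℕ) → (Vec (Fin n) q → ℚ) → (Fin n → ℚ) → ℚ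
accProb n q T μ = sumL (allSeqs n q) (λ x → seqProb μ x * T x)

IsOneSidedTest : (m n : ℕ) → ℚ → (q : ℕ) → (Vec (Fin n) q → ℚ) → Set
IsOneSidedTest m n ε q T =
  IsTestFn n q T
  × (∀ μ → InS m n μ → accProb n q T μ ≡ 1ℚ)
  × (∀ μ → IsDistribution n μ → FarFromS m n ε μ → (+ 2 / 3) < 1ℚ - accProb n q T μ)
  where open import Relation.Binary.PropositionalEquality using (_≡_)

-- Let μ put mass 1 - 4ε on the point 0 and 2ε/m on each of 2m further points. Any ν supported
-- on m points misses at least m of the light points, so d(μ, ν) ≥ 2ε > ε and μ must be
-- rejected with probability > 2/3. On the other hand a one-sided test must accept every sample
-- sequence that a distribution in S_m can produce; when at most m - 1 samples differ from 0 the
-- uniform distribution on {0} ∪ {samples} is such a distribution. So the test rejects μ only if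
-- at least m samples avoid 0, which by Markov's inequality happens with probability at most
-- q · 4ε / m. Hence 2/3 < 4εq/m, i.e. q > m/(6ε).

module Submission where

open import Defs
open import Data.Bool using (Bool; true; false; if_then_else_; _∨_; not)
open import Data.Bool.Properties using (∨-zeroʳ; ∨-identityʳ; ∨-assoc; ∨-idem)
open import Data.Fin as F using (Fin; zero; suc; _≟_)
open import Data.Integer as ℤ using (1ℤ)
import Data.Integer.Properties as ℤP
import Data.Integer.Solver as ℤSolver
open import Data.List using (List; []; _∷_; map; concatMap; allFin; filter; length; _++_)
open import Data.List.Membership.Propositional using (_∈_)
open import Data.List.Membership.Propositional.Properties using (∈-allFin; ∈-map⁺; ∈-concatMap⁺)
import Data.List.Properties as ListP
import Data.List.Relation.Unary.Any as Any
open import Data.List.Relation.Unary.Any using (here; there)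
open import Data.Nat as ℕ using (ℕ; _<ᵇ_)
import Data.Nat.Properties as ℕP
open import Data.Nat.Coprimality using (1-coprimeTo)
import Data.Nat.Coprimality as Coprimality
open import Data.Product using (Σ; _×_; _,_; proj₁; proj₂)
open import Data.Rational as ℚ using (ℚ; mkℚ; 0ℚ; 1ℚ; ½; _+_; _*_; _-_; -_; 1/_; _≤_; _<_; ∣_∣; *≤*)
import Data.Rational.Properties as ℚP
import Data.Rational.Solver as ℚSolver
import Data.Rational.Unnormalised as ℚᵘ
import Data.Rational.Unnormalised.Properties as ℚᵘP
open import Data.Sum using (inj₁; inj₂)
open import Data.Vec as Vec using (Vec)
open import Data.Vec.Relation.Unary.All as All using (All)
open import Function using (_∘_)
open import Relation.Binary.PropositionalEquality
open import Relation.Nullary using (does; ¬?; yes; no)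
open import Relation.Nullary.Decidable using (dec-true; dec-false)
open import Relation.Unary using (Pred; Decidable)
open import Algebra.Properties.CommutativeSemigroup ℕP.+-commutativeSemigroup using () renaming (interchange to ℕ-interchange)

open ℚSolver.+-*-Solver using (solve; _:+_; _:*_; _:-_; :-_; _:=_; con)

-- ℕ→ℚ goes through normalize, which does not compute on variables; fromℕ is the same
-- number written in normal form.
fromℕ : ℕ → ℚ
fromℕ k = mkℚ (ℤ.+ k) 0 (Coprimality.sym (1-coprimeTo k))

ℕ→ℚ≡fromℕ : ∀ k → ℕ→ℚ k ≡ fromℕ k
ℕ→ℚ≡fromℕ k = ℚP.normalize-coprime _

fromℕ-+ : ∀ a b → fromℕ (a ℕ.+ b) ≡ fromℕ a + fromℕ b
fromℕ-+ a b = ℚP.toℚᵘ-injective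
  (ℚᵘP.≃-trans (ℚᵘ.*≡* cross-multiplied) (ℚᵘP.≃-sym (ℚP.toℚᵘ-homo-+ (fromℕ a) (fromℕ b))))
  where
  open ℤSolver.+-*-Solver using () renaming (solve to solveℤ; _:+_ to _⊕_; _:*_ to _⊗_; _:=_ to _≐_; con to c)
  cross-multiplied : ℤ.+ (a ℕ.+ b) ℤ.* (ℤ.+ 1 ℤ.* ℤ.+ 1) ≡ (ℤ.+ a ℤ.* ℤ.+ 1 ℤ.+ ℤ.+ b ℤ.* ℤ.+ 1) ℤ.* ℤ.+ 1
  cross-multiplied rewrite ℤP.pos-+ a b =
    solveℤ 2 (λ x y → (x ⊕ y) ⊗ (c 1ℤ ⊗ c 1ℤ) ≐ (x ⊗ c 1ℤ ⊕ y ⊗ c 1ℤ) ⊗ c 1ℤ) refl (ℤ.+ a) (ℤ.+ b)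

ℕ→ℚ-+ : ∀ a b → ℕ→ℚ (a ℕ.+ b) ≡ ℕ→ℚ a + ℕ→ℚ b
ℕ→ℚ-+ a b rewrite ℕ→ℚ≡fromℕ a | ℕ→ℚ≡fromℕ b | ℕ→ℚ≡fromℕ (a ℕ.+ b) = fromℕ-+ a b

ℕ→ℚ-mono-≤ : ∀ {a b} → a ℕ.≤ b → ℕ→ℚ a ≤ ℕ→ℚ b
ℕ→ℚ-mono-≤ {a} {b} a≤b rewrite ℕ→ℚ≡fromℕ a | ℕ→ℚ≡fromℕ b =
  *≤* (subst₂ ℤ._≤_ (sym (ℤP.*-identityʳ _)) (sym (ℤP.*-identityʳ _)) (ℤ.+≤+ a≤b))

ℕ→ℚ-nonNeg : ∀ a → 0ℚ ≤ ℕ→ℚ a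
ℕ→ℚ-nonNeg a = ℕ→ℚ-mono-≤ (ℕ.z≤n {a})

nonNeg*nonNeg : ∀ {p q} → 0ℚ ≤ p → 0ℚ ≤ q → 0ℚ ≤ p * q
nonNeg*nonNeg {p} {q} 0≤p 0≤q = subst (_≤ p * q) (ℚP.*-zeroʳ p) (ℚP.*-monoˡ-≤-nonNeg p {{ℚ.nonNegative 0≤p}} 0≤q)

pos*pos : ∀ {p q} → 0ℚ < p → 0ℚ < q → 0ℚ < p * q
pos*pos {p} {q} 0<p 0<q = subst (_< p * q) (ℚP.*-zeroʳ p) (ℚP.*-monoʳ-<-pos p {{ℚ.positive 0<p}} 0<q)

*-monoˡ-≤ : ∀ {r p q} → 0ℚ ≤ r → p ≤ q → r * p ≤ r * q
*-monoˡ-≤ {r} 0≤r = ℚP.*-monoˡ-≤-nonNeg r {{ℚ.nonNegative 0≤r}}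

p≤q⇒0≤q-p : ∀ {p q} → p ≤ q → 0ℚ ≤ q - p
p≤q⇒0≤q-p {p} {q} p≤q = subst (_≤ q - p) (ℚP.+-inverseʳ p) (ℚP.+-monoˡ-≤ (- p) p≤q)

0≤p⇒1-p≤1 : ∀ {p} → 0ℚ ≤ p → 1ℚ - p ≤ 1ℚ
0≤p⇒1-p≤1 {p} 0≤p = subst (1ℚ - p ≤_) (ℚP.+-identityʳ 1ℚ) (ℚP.+-monoʳ-≤ 1ℚ (ℚP.neg-antimono-≤ 0≤p))

p≤∣p∣ : ∀ p → p ≤ ∣ p ∣
p≤∣p∣ p with ℚP.∣p∣≡p∨∣p∣≡-p p
... | inj₁ ∣p∣≡p  = ℚP.≤-reflexive (sym ∣p∣≡p)
... | inj₂ ∣p∣≡-p = ℚP.≤-trans p≤0 (ℚP.0≤∣p∣ p)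
  where
  p≤0 : p ≤ 0ℚ
  p≤0 = subst (_≤ 0ℚ) (solve 1 (λ x → :- (:- x) := x) refl p)
          (ℚP.neg-antimono-≤ (subst (0ℚ ≤_) ∣p∣≡-p (ℚP.0≤∣p∣ p)))

𝟙 : Bool → ℕ
𝟙 true  = 1
𝟙 false = 0

count : {A : Set} → (A → Bool) → List A → ℕ
count b []       = 0
count b (x ∷ xs) = 𝟙 (b x) ℕ.+ count b xs

module _ {A : Set} where

  sumL-++ : ∀ (xs ys : List A) f → sumL (xs ++ ys) f ≡ sumL xs f + sumL ys f
  sumL-++ []       ys f = sym (ℚP.+-identityˡ _)
  sumL-++ (x ∷ xs) ys f rewrite sumL-++ xs ys f = sym (ℚP.+-assoc (f x) _ _)

  sumL-cong : ∀ (xs : List A) {f g} → (∀ x → f x ≡ g x) → sumL xs f ≡ sumL xs g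
  sumL-cong []       f≡g = refl
  sumL-cong (x ∷ xs) f≡g = cong₂ _+_ (f≡g x) (sumL-cong xs f≡g)

  sumL-zero : ∀ (xs : List A) → sumL xs (λ _ → 0ℚ) ≡ 0ℚ
  sumL-zero []       = refl
  sumL-zero (x ∷ xs) rewrite sumL-zero xs = refl

  sumL-+ : ∀ (xs : List A) f g → sumL xs (λ x → f x + g x) ≡ sumL xs f + sumL xs g
  sumL-+ []       f g = refl
  sumL-+ (x ∷ xs) f g rewrite sumL-+ xs f g =
    solve 4 (λ a b c d → (a :+ b) :+ (c :+ d) := (a :+ c) :+ (b :+ d)) refl (f x) (g x) (sumL xs f) (sumL xs g)

  sumL-- : ∀ (xs : List A) f g → sumL xs (λ x → f x - g x) ≡ sumL xs f - sumL xs g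
  sumL-- []       f g = refl
  sumL-- (x ∷ xs) f g rewrite sumL-- xs f g =
    solve 4 (λ a b c d → (a :- b) :+ (c :- d) := (a :+ c) :- (b :+ d)) refl (f x) (g x) (sumL xs f) (sumL xs g)

  sumL-* : ∀ (xs : List A) c f → sumL xs (λ x → c * f x) ≡ c * sumL xs f
  sumL-* []       c f = sym (ℚP.*-zeroʳ c)
  sumL-* (x ∷ xs) c f rewrite sumL-* xs c f = sym (ℚP.*-distribˡ-+ c (f x) (sumL xs f))

  sumL-mono-≤ : ∀ (xs : List A) {f g} → (∀ x → f x ≤ g x) → sumL xs f ≤ sumL xs g
  sumL-mono-≤ []       f≤g = ℚP.≤-refl
  sumL-mono-≤ (x ∷ xs) f≤g = ℚP.+-mono-≤ (f≤g x) (sumL-mono-≤ xs f≤g)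

  sumL-nonNeg : ∀ (xs : List A) {f} → (∀ x → 0ℚ ≤ f x) → 0ℚ ≤ sumL xs f
  sumL-nonNeg xs {f} 0≤f = subst (_≤ sumL xs f) (sumL-zero xs) (sumL-mono-≤ xs 0≤f)

  ∈⇒≤sumL : ∀ {xs : List A} {f} → (∀ x → 0ℚ ≤ f x) → ∀ {x} → x ∈ xs → f x ≤ sumL xs f
  ∈⇒≤sumL {y ∷ xs} {f} 0≤f (here refl) =
    subst (_≤ f y + sumL xs f) (ℚP.+-identityʳ (f y)) (ℚP.+-monoʳ-≤ (f y) (sumL-nonNeg xs 0≤f))
  ∈⇒≤sumL {y ∷ xs} {f} 0≤f (there x∈xs) =
    ℚP.≤-trans (∈⇒≤sumL 0≤f x∈xs)
      (subst (_≤ f y + sumL xs f) (ℚP.+-identityˡ _) (ℚP.+-monoˡ-≤ (sumL xs f) (0≤f y)))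

  sumL-if : ∀ (b : A → Bool) r xs → sumL xs (λ x → if b x then r else 0ℚ) ≡ ℕ→ℚ (count b xs) * r
  sumL-if b r []       = sym (ℚP.*-zeroˡ r)
  sumL-if b r (x ∷ xs) with b x
  ... | true  rewrite sumL-if b r xs | ℕ→ℚ-+ 1 (count b xs) =
    solve 2 (λ r n → r :+ n :* r := (con 1ℚ :+ n) :* r) refl r (ℕ→ℚ (count b xs))
  ... | false rewrite sumL-if b r xs = ℚP.+-identityˡ _

  sumL-if-split : ∀ (b : A → Bool) f xs →
    sumL xs (λ x → if b x then 0ℚ else f x) + sumL xs (λ x → if b x then f x else 0ℚ) ≡ sumL xs f
  sumL-if-split b f xs =
    trans (sym (sumL-+ xs (λ x → if b x then 0ℚ else f x) (λ x → if b x then f x else 0ℚ))) (sumL-cong xs split)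
    where
    split : ∀ x → (if b x then 0ℚ else f x) + (if b x then f x else 0ℚ) ≡ f x
    split x with b x
    ... | true  = ℚP.+-identityˡ (f x)
    ... | false = ℚP.+-identityʳ (f x)

  length-filter≡count : ∀ {p} {P : Pred A p} (P? : Decidable P) xs → length (filter P? xs) ≡ count (does ∘ P?) xs
  length-filter≡count P? []       = refl
  length-filter≡count P? (x ∷ xs) with does (P? x)
  ... | true  = cong ℕ.suc (length-filter≡count P? xs)
  ... | false = length-filter≡count P? xs

  count-cong : ∀ {b c : A → Bool} xs → (∀ x → b x ≡ c x) → count b xs ≡ count c xs
  count-cong []       b≡c = refl
  count-cong (x ∷ xs) b≡c = cong₂ ℕ._+_ (cong 𝟙 (b≡c x)) (count-cong xs b≡c)

  count-false : ∀ (xs : List A) → count (λ _ → false) xs ≡ 0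
  count-false []       = refl
  count-false (x ∷ xs) = count-false xs

  count-subadditive : ∀ {b c d : A → Bool} xs → (∀ x → 𝟙 (b x) ℕ.≤ 𝟙 (c x) ℕ.+ 𝟙 (d x)) →
    count b xs ℕ.≤ count c xs ℕ.+ count d xs
  count-subadditive []       _ = ℕ.z≤n
  count-subadditive {b} {c} {d} (x ∷ xs) b≤c+d = begin
    𝟙 (b x) ℕ.+ count b xs                                ≤⟨ ℕP.+-mono-≤ (b≤c+d x) (count-subadditive xs b≤c+d) ⟩
    (𝟙 (c x) ℕ.+ 𝟙 (d x)) ℕ.+ (count c xs ℕ.+ count d xs) ≡⟨ ℕ-interchange (𝟙 (c x)) (𝟙 (d x)) (count c xs) (count d xs) ⟩
    (𝟙 (c x) ℕ.+ count c xs) ℕ.+ (𝟙 (d x) ℕ.+ count d xs) ∎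
    where open ℕP.≤-Reasoning

module _ {A B : Set} where

  sumL-map : ∀ (g : A → B) xs f → sumL (map g xs) f ≡ sumL xs (f ∘ g)
  sumL-map g []       f = refl
  sumL-map g (x ∷ xs) f = cong (f (g x) +_) (sumL-map g xs f)

  count-map : ∀ (g : A → B) b xs → count b (map g xs) ≡ count (b ∘ g) xs
  count-map g b []       = refl
  count-map g b (x ∷ xs) = cong (𝟙 (b (g x)) ℕ.+_) (count-map g b xs)

  sumL-concatMap : ∀ (h : A → List B) xs f → sumL (concatMap h xs) f ≡ sumL xs (λ x → sumL (h x) f)
  sumL-concatMap h []       f = refl
  sumL-concatMap h (x ∷ xs) f rewrite sym (sumL-concatMap h xs f) = sumL-++ (h x) (concatMap h xs) f

allFin-suc : ∀ n → allFin (ℕ.suc n) ≡ zero ∷ map suc (allFin n)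
allFin-suc n = cong (zero ∷_) (sym (ListP.map-tabulate (λ i → i) suc))

sumΩ-suc : ∀ n f → sumΩ (ℕ.suc n) f ≡ f zero + sumΩ n (f ∘ suc)
sumΩ-suc n f = trans (cong (λ us → sumL us f) (allFin-suc n)) (cong (f zero +_) (sumL-map suc (allFin n) f))

count-allFin-suc : ∀ n (b : Fin (ℕ.suc n) → Bool) → count b (allFin (ℕ.suc n)) ≡ 𝟙 (b zero) ℕ.+ count (b ∘ suc) (allFin n)
count-allFin-suc n b =
  trans (cong (count b) (allFin-suc n)) (cong (𝟙 (b zero) ℕ.+_) (count-map suc b (allFin n)))

count-∘suc≤ : ∀ n (b : Fin (ℕ.suc n) → Bool) → count (b ∘ suc) (allFin n) ℕ.≤ count b (allFin (ℕ.suc n))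
count-∘suc≤ n b = ℕP.≤-trans (ℕP.m≤n+m _ (𝟙 (b zero))) (ℕP.≤-reflexive (sym (count-allFin-suc n b)))

count-≟ : ∀ {n} (v : Fin n) → count (λ u → does (u ≟ v)) (allFin n) ≡ 1
count-≟ {ℕ.suc n} zero    = trans (count-allFin-suc n (λ u → does (u ≟ zero))) (cong ℕ.suc (count-false (allFin n)))
count-≟ {ℕ.suc n} (suc v) = trans (count-allFin-suc n (λ u → does (u ≟ suc v))) (count-≟ v)

count-<ᵇ : ∀ {t n} → t ℕ.≤ n → count (λ u → F.toℕ u <ᵇ t) (allFin n) ≡ t
count-<ᵇ {ℕ.zero}  {n}       _         = count-false (allFin n)
count-<ᵇ {ℕ.suc t} {ℕ.suc n} (ℕ.s≤s t≤n) = trans (count-allFin-suc n (λ u → F.toℕ u <ᵇ ℕ.suc t)) (cong ℕ.suc (count-<ᵇ t≤n))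

∈-allSeqs : ∀ {n q} (x : Vec (Fin n) q) → x ∈ allSeqs n q
∈-allSeqs Vec.[]      = here refl
∈-allSeqs (v Vec.∷ x) =
  ∈-concatMap⁺ (λ u → map (u Vec.∷_) (allSeqs _ _)) (Any.map (λ { refl → ∈-map⁺ (v Vec.∷_) (∈-allSeqs x) }) (∈-allFin v))

sumL-allSeqs-suc : ∀ n q (f : Vec (Fin n) (ℕ.suc q) → ℚ) →
  sumL (allSeqs n (ℕ.suc q)) f ≡ sumΩ n (λ v → sumL (allSeqs n q) (λ x → f (v Vec.∷ x)))
sumL-allSeqs-suc n q f = trans (sumL-concatMap _ (allFin n) f)
  (sumL-cong (allFin n) (λ v → sumL-map (v Vec.∷_) (allSeqs n q) f))

seqProb-nonNeg : ∀ {n q} {μ : Fin n → ℚ} → (∀ u → 0ℚ ≤ μ u) → (x : Vec (Fin n) q) → 0ℚ ≤ seqProb μ x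
seqProb-nonNeg 0≤μ Vec.[]      = ℚP.nonNegative⁻¹ 1ℚ
seqProb-nonNeg 0≤μ (v Vec.∷ x) = nonNeg*nonNeg (0≤μ v) (seqProb-nonNeg 0≤μ x)

seqProb-pos : ∀ {n q} {μ : Fin n → ℚ} {x : Vec (Fin n) q} → All (λ u → 0ℚ < μ u) x → 0ℚ < seqProb μ x
seqProb-pos All.[]           = ℚP.positive⁻¹ 1ℚ
seqProb-pos (0<μv All.∷ 0<μx) = pos*pos 0<μv (seqProb-pos 0<μx)

sumL-seqProb : ∀ n q (μ : Fin n → ℚ) → sumΩ n μ ≡ 1ℚ → sumL (allSeqs n q) (seqProb μ) ≡ 1ℚ
sumL-seqProb n ℕ.zero    μ Σμ≡1 = refl
sumL-seqProb n (ℕ.suc q) μ Σμ≡1 = begin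
  sumL (allSeqs n (ℕ.suc q)) (seqProb μ)                    ≡⟨ sumL-allSeqs-suc n q (seqProb μ) ⟩
  sumΩ n (λ v → sumL (allSeqs n q) (λ x → μ v * seqProb μ x)) ≡⟨ sumL-cong (allFin n) (λ v → sumL-* (allSeqs n q) (μ v) (seqProb μ)) ⟩
  sumΩ n (λ v → μ v * sumL (allSeqs n q) (seqProb μ))       ≡⟨ sumL-cong (allFin n) (λ v → cong (μ v *_) (sumL-seqProb n q μ Σμ≡1)) ⟩
  sumΩ n (λ v → μ v * 1ℚ)                                   ≡⟨ sumL-cong (allFin n) (λ v → ℚP.*-identityʳ (μ v)) ⟩
  sumΩ n μ                                                  ≡⟨ Σμ≡1 ⟩
  1ℚ                                                        ∎
  where open ≡-Reasoning

expectation-additive : ∀ n q (μ : Fin n → ℚ) (g : Fin n → ℕ) → sumΩ n μ ≡ 1ℚ →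
  sumL (allSeqs n q) (λ x → seqProb μ x * ℕ→ℚ (Vec.sum (Vec.map g x)))
    ≡ ℕ→ℚ q * sumΩ n (λ v → μ v * ℕ→ℚ (g v))
expectation-additive n ℕ.zero    μ g Σμ≡1 = sym (ℚP.*-zeroˡ (sumΩ n (λ v → μ v * ℕ→ℚ (g v))))
expectation-additive n (ℕ.suc q) μ g Σμ≡1 = begin
  sumL (allSeqs n (ℕ.suc q)) (λ x → seqProb μ x * G x)
    ≡⟨ sumL-allSeqs-suc n q (λ x → seqProb μ x * G x) ⟩
  sumΩ n (λ v → sumL S (λ x → μ v * seqProb μ x * ℕ→ℚ (g v ℕ.+ Vec.sum (Vec.map g x))))
    ≡⟨ sumL-cong (allFin n) (λ v → sumL-cong S (split v)) ⟩
  sumΩ n (λ v → sumL S (λ x → μ v * (ℕ→ℚ (g v) * seqProb μ x + seqProb μ x * G x)))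
    ≡⟨ sumL-cong (allFin n) given-first-sample ⟩
  sumΩ n (λ v → μ v * ℕ→ℚ (g v) + (ℕ→ℚ q * E) * μ v)
    ≡⟨ sumL-+ (allFin n) (λ v → μ v * ℕ→ℚ (g v)) (λ v → (ℕ→ℚ q * E) * μ v) ⟩
  E + sumΩ n (λ v → (ℕ→ℚ q * E) * μ v)
    ≡⟨ cong (E +_) (trans (sumL-* (allFin n) (ℕ→ℚ q * E) μ) (cong ((ℕ→ℚ q * E) *_) Σμ≡1)) ⟩
  E + (ℕ→ℚ q * E) * 1ℚ
    ≡⟨ solve 2 (λ e q → e :+ (q :* e) :* con 1ℚ := (con 1ℚ :+ q) :* e) refl E (ℕ→ℚ q) ⟩
  (1ℚ + ℕ→ℚ q) * E
    ≡⟨ cong (_* E) (sym (ℕ→ℚ-+ 1 q)) ⟩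
  ℕ→ℚ (ℕ.suc q) * E ∎
  where
  open ≡-Reasoning
  S = allSeqs n q
  G : ∀ {k} → Vec (Fin n) k → ℚ
  G x = ℕ→ℚ (Vec.sum (Vec.map g x))
  E = sumΩ n (λ v → μ v * ℕ→ℚ (g v))
  split : ∀ v x → μ v * seqProb μ x * ℕ→ℚ (g v ℕ.+ Vec.sum (Vec.map g x))
                ≡ μ v * (ℕ→ℚ (g v) * seqProb μ x + seqProb μ x * G x)
  split v x rewrite ℕ→ℚ-+ (g v) (Vec.sum (Vec.map g x)) =
    solve 4 (λ m p a b → m :* p :* (a :+ b) := m :* (a :* p :+ p :* b)) refl (μ v) (seqProb μ x) (ℕ→ℚ (g v)) (G x)
  given-first-sample : ∀ v → sumL S (λ x → μ v * (ℕ→ℚ (g v) * seqProb μ x + seqProb μ x * G x))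
                              ≡ μ v * ℕ→ℚ (g v) + (ℕ→ℚ q * E) * μ v
  given-first-sample v = begin
    sumL S (λ x → μ v * (ℕ→ℚ (g v) * seqProb μ x + seqProb μ x * G x))
      ≡⟨ sumL-* S (μ v) _ ⟩
    μ v * sumL S (λ x → ℕ→ℚ (g v) * seqProb μ x + seqProb μ x * G x)
      ≡⟨ cong (μ v *_) (sumL-+ S (λ x → ℕ→ℚ (g v) * seqProb μ x) (λ x → seqProb μ x * G x)) ⟩
    μ v * (sumL S (λ x → ℕ→ℚ (g v) * seqProb μ x) + sumL S (λ x → seqProb μ x * G x))
      ≡⟨ cong (μ v *_) (cong₂ _+_ (trans (sumL-* S (ℕ→ℚ (g v)) (seqProb μ)) (cong (ℕ→ℚ (g v) *_) (sumL-seqProb n q μ Σμ≡1)))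
                                  (expectation-additive n q μ g Σμ≡1)) ⟩
    μ v * (ℕ→ℚ (g v) * 1ℚ + ℕ→ℚ q * E)
      ≡⟨ solve 4 (λ m a q e → m :* (a :* con 1ℚ :+ q :* e) := m :* a :+ (q :* e) :* m) refl (μ v) (ℕ→ℚ (g v)) (ℕ→ℚ q) E ⟩
    μ v * ℕ→ℚ (g v) + (ℕ→ℚ q * E) * μ v ∎

1-accProb≡sumL : ∀ n q (T : Vec (Fin n) q → ℚ) (μ : Fin n → ℚ) → sumΩ n μ ≡ 1ℚ →
  1ℚ - accProb n q T μ ≡ sumL (allSeqs n q) (λ x → seqProb μ x * (1ℚ - T x))
1-accProb≡sumL n q T μ Σμ≡1 = begin
  1ℚ - accProb n q T μ                            ≡⟨ cong (_- accProb n q T μ) (sym (sumL-seqProb n q μ Σμ≡1)) ⟩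
  sumL S (seqProb μ) - sumL S (λ x → seqProb μ x * T x) ≡⟨ sym (sumL-- S (seqProb μ) (λ x → seqProb μ x * T x)) ⟩
  sumL S (λ x → seqProb μ x - seqProb μ x * T x)  ≡⟨ sumL-cong S (λ x → solve 2 (λ p t → p :- p :* t := p :* (con 1ℚ :- t)) refl (seqProb μ x) (T x)) ⟩
  sumL S (λ x → seqProb μ x * (1ℚ - T x))         ∎
  where
  open ≡-Reasoning
  S = allSeqs n q

1-p≤0⇒1≤p : ∀ {p} → 1ℚ - p ≤ 0ℚ → 1ℚ ≤ p
1-p≤0⇒1≤p {p} 1-p≤0 = subst₂ _≤_ (solve 1 (λ p → (con 1ℚ :- p) :+ p := con 1ℚ) refl p) (ℚP.+-identityˡ p)
  (ℚP.+-monoˡ-≤ p 1-p≤0)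

accProb≡1⇒T≡1 : ∀ n q (T : Vec (Fin n) q → ℚ) → IsTestFn n q T → (ν : Fin n → ℚ) → IsDistribution n ν →
  accProb n q T ν ≡ 1ℚ → ∀ x → 0ℚ < seqProb ν x → T x ≡ 1ℚ
accProb≡1⇒T≡1 n q T T∈[0,1] ν (0≤ν , Σν≡1) acc≡1 x 0<px =
  ℚP.≤-antisym (proj₂ (T∈[0,1] x)) (1-p≤0⇒1≤p 1-Tx≤0)
  where
  rejection : Vec (Fin n) q → ℚ
  rejection y = seqProb ν y * (1ℚ - T y)
  no-rejection : sumL (allSeqs n q) rejection ≡ 0ℚ
  no-rejection = trans (sym (1-accProb≡sumL n q T ν Σν≡1)) (cong (λ a → 1ℚ - a) acc≡1)
  rejection-at-x≤0 : rejection x ≤ 0ℚ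
  rejection-at-x≤0 = subst (rejection x ≤_) no-rejection
    (∈⇒≤sumL (λ y → nonNeg*nonNeg (seqProb-nonNeg 0≤ν y) (p≤q⇒0≤q-p (proj₂ (T∈[0,1] y)))) (∈-allSeqs x))
  1-Tx≤0 : 1ℚ - T x ≤ 0ℚ
  1-Tx≤0 = ℚP.≮⇒≥ (λ 0<1-Tx → ℚP.<-irrefl refl (ℚP.<-≤-trans (pos*pos 0<px 0<1-Tx) rejection-at-x≤0))

if-mono-≤ : ∀ b {p q} → p ≤ q → (if b then p else 0ℚ) ≤ (if b then q else 0ℚ)
if-mono-≤ true  p≤q = p≤q
if-mono-≤ false _   = ℚP.≤-refl

if-nonNeg : ∀ b {p} → 0ℚ ≤ p → 0ℚ ≤ (if b then p else 0ℚ)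
if-nonNeg true  0≤p = 0≤p
if-nonNeg false _   = ℚP.≤-refl

if-≤ : ∀ b {p} → 0ℚ ≤ p → (if b then p else 0ℚ) ≤ p
if-≤ true  _   = ℚP.≤-refl
if-≤ false 0≤p = 0≤p

inSupport : ∀ {n} → (Fin n → ℚ) → Fin n → Bool
inSupport ν u = does (¬? (ν u ℚP.≟ 0ℚ))

supportSize≡count : ∀ n (ν : Fin n → ℚ) → supportSize n ν ≡ count (inSupport ν) (allFin n)
supportSize≡count n ν = length-filter≡count (λ u → ¬? (ν u ℚP.≟ 0ℚ)) (allFin n)

module _ {n} (B : Fin n → Bool) .{{_ : ℕ.NonZero (count B (allFin n))}} where

  private
    weight : ℚ
    weight = 1/ fromℕ (count B (allFin n))

    weight-pos : 0ℚ < weight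
    weight-pos = ℚP.positive⁻¹ weight {{ℚP.1/pos⇒pos k {{ℚP.nonNeg∧nonZero⇒pos k}}}}
      where k = fromℕ (count B (allFin n))

  uniformOn : Fin n → ℚ
  uniformOn u = if B u then weight else 0ℚ

  uniformOn-pos : ∀ {u} → B u ≡ true → 0ℚ < uniformOn u
  uniformOn-pos Bu≡true rewrite Bu≡true = weight-pos

  uniformOn-isDistribution : IsDistribution n uniformOn
  uniformOn-isDistribution = (λ u → if-nonNeg (B u) {weight} (ℚP.<⇒≤ weight-pos)) , mass
    where
    mass : sumΩ n uniformOn ≡ 1ℚ
    mass = trans (sumL-if B weight (allFin n))
      (trans (cong (_* weight) (ℕ→ℚ≡fromℕ (count B (allFin n)))) (ℚP.*-inverseʳ (fromℕ (count B (allFin n)))))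

  supportSize-uniformOn : supportSize n uniformOn ≡ count B (allFin n)
  supportSize-uniformOn = trans (supportSize≡count n uniformOn) (count-cong (allFin n) (λ u → nonZero⇔ (B u)))
    where
    nonZero⇔ : ∀ b → does (¬? ((if b then weight else 0ℚ) ℚP.≟ 0ℚ)) ≡ b
    nonZero⇔ true  = cong not (dec-false (weight ℚP.≟ 0ℚ) (λ eq → ℚP.<-irrefl (sym eq) weight-pos))
    nonZero⇔ false = refl

_∈ᵇ_ : ∀ {n q} → Fin n → Vec (Fin n) q → Bool
u ∈ᵇ Vec.[]      = false
u ∈ᵇ (v Vec.∷ x) = does (u ≟ v) ∨ u ∈ᵇ x

∈ᵇ-self : ∀ {n q} (x : Vec (Fin n) q) → All (λ u → u ∈ᵇ x ≡ true) x
∈ᵇ-self Vec.[]      = All.[]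
∈ᵇ-self (v Vec.∷ x) = cong (_∨ v ∈ᵇ x) (dec-true (v ≟ v) refl)
                All.∷ All.map (λ {u} u∈x → trans (cong (does (u ≟ v) ∨_) u∈x) (∨-zeroʳ _)) (∈ᵇ-self x)

offBase : ∀ {n} → Fin (ℕ.suc n) → ℕ
offBase zero    = 0
offBase (suc _) = 1

offBaseCount : ∀ {n q} → Vec (Fin (ℕ.suc n)) q → ℕ
offBaseCount x = Vec.sum (Vec.map offBase x)

count-seen≤ : ∀ {n q} (x : Vec (Fin (ℕ.suc n)) q) →
  count (_∈ᵇ (zero Vec.∷ x)) (allFin (ℕ.suc n)) ℕ.≤ ℕ.suc (offBaseCount x)
count-seen≤ {n} Vec.[] = ℕP.≤-reflexive
  (trans (count-cong (allFin (ℕ.suc n)) (λ u → ∨-identityʳ (does (u ≟ zero)))) (count-≟ {ℕ.suc n} zero))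
count-seen≤ {n} (zero Vec.∷ x) = ℕP.≤-trans
  (ℕP.≤-reflexive (count-cong (allFin (ℕ.suc n)) (λ u → repeat (does (u ≟ zero)) (u ∈ᵇ x)))) (count-seen≤ x)
  where
  repeat : ∀ a b → a ∨ (a ∨ b) ≡ a ∨ b
  repeat a b = trans (sym (∨-assoc a a b)) (cong (_∨ b) (∨-idem a))
count-seen≤ {n} (suc v Vec.∷ x) = begin
  count (_∈ᵇ (zero Vec.∷ suc v Vec.∷ x)) Ω                    ≤⟨ count-subadditive {c = λ u → does (u ≟ suc v)} {d = _∈ᵇ (zero Vec.∷ x)} Ω (λ u → 𝟙-∨-≤ (does (u ≟ zero)) (does (u ≟ suc v)) (u ∈ᵇ x)) ⟩
  count (λ u → does (u ≟ suc v)) Ω ℕ.+ count (_∈ᵇ (zero Vec.∷ x)) Ω ≤⟨ ℕP.+-mono-≤ (ℕP.≤-reflexive (count-≟ (suc v))) (count-seen≤ x) ⟩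
  1 ℕ.+ ℕ.suc (offBaseCount x)                                 ∎
  where
  open ℕP.≤-Reasoning
  Ω = allFin (ℕ.suc n)
  𝟙-∨-≤ : ∀ a b c → 𝟙 (a ∨ (b ∨ c)) ℕ.≤ 𝟙 b ℕ.+ 𝟙 (a ∨ c)
  𝟙-∨-≤ true  b     c = ℕP.m≤n+m 1 (𝟙 b)
  𝟙-∨-≤ false true  c = ℕ.s≤s ℕ.z≤n
  𝟙-∨-≤ false false c = ℕP.≤-refl

expected-offBase : ∀ n (μ : Fin (ℕ.suc n) → ℚ) → sumΩ (ℕ.suc n) μ ≡ 1ℚ →
  sumΩ (ℕ.suc n) (λ v → μ v * ℕ→ℚ (offBase v)) ≡ 1ℚ - μ zero
expected-offBase n μ Σμ≡1 = begin
  sumΩ (ℕ.suc n) (λ v → μ v * ℕ→ℚ (offBase v)) ≡⟨ sumΩ-suc n (λ v → μ v * ℕ→ℚ (offBase v)) ⟩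
  μ zero * 0ℚ + sumΩ n (λ v → μ (suc v) * 1ℚ) ≡⟨ cong₂ _+_ (ℚP.*-zeroʳ (μ zero)) (sumL-cong (allFin n) (λ v → ℚP.*-identityʳ (μ (suc v)))) ⟩
  0ℚ + sumΩ n (μ ∘ suc)                        ≡⟨ solve 2 (λ a s → con 0ℚ :+ s := (a :+ s) :- a) refl (μ zero) (sumΩ n (μ ∘ suc)) ⟩
  (μ zero + sumΩ n (μ ∘ suc)) - μ zero         ≡⟨ cong (_- μ zero) (trans (sym (sumΩ-suc n μ)) Σμ≡1) ⟩
  1ℚ - μ zero                                  ∎
  where open ≡-Reasoning

module _ {m n ε q} {T : Vec (Fin (ℕ.suc n)) q → ℚ} (test : IsOneSidedTest m (ℕ.suc n) ε q T) where

  -- The uniform distribution on the points seen (and zero) lies in S_m and produces x.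
  accepts-few-offBase : ∀ x → ℕ.suc (offBaseCount x) ℕ.≤ m → T x ≡ 1ℚ
  accepts-few-offBase x few = accProb≡1⇒T≡1 (ℕ.suc n) q T (proj₁ test) ν ν-dist (proj₁ (proj₂ test) ν ν∈S) x ν-produces-x
    where
    seen = _∈ᵇ (zero Vec.∷ x)
    ν = uniformOn seen
    ν-dist = uniformOn-isDistribution seen
    ν∈S : InS m (ℕ.suc n) ν
    ν∈S = ν-dist , subst (ℕ._≤ m) (sym (supportSize-uniformOn seen)) (ℕP.≤-trans (count-seen≤ x) few)
    ν-produces-x : 0ℚ < seqProb ν x
    ν-produces-x = seqProb-pos (All.map (λ {u} u∈x → uniformOn-pos seen (trans (cong (does (u ≟ zero) ∨_) u∈x) (∨-zeroʳ _))) (∈ᵇ-self x))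

  -- Markov's inequality: the test can only reject when offBaseCount ≥ m.
  rejection-bound : ∀ μ → IsDistribution (ℕ.suc n) μ →
    ℕ→ℚ m * (1ℚ - accProb (ℕ.suc n) q T μ) ≤ ℕ→ℚ q * (1ℚ - μ zero)
  rejection-bound μ (0≤μ , Σμ≡1) = begin
    ℕ→ℚ m * (1ℚ - accProb (ℕ.suc n) q T μ)         ≡⟨ cong (ℕ→ℚ m *_) (1-accProb≡sumL (ℕ.suc n) q T μ Σμ≡1) ⟩
    ℕ→ℚ m * sumL S (λ y → seqProb μ y * (1ℚ - T y)) ≡⟨ sym (sumL-* S (ℕ→ℚ m) (λ y → seqProb μ y * (1ℚ - T y))) ⟩
    sumL S (λ y → ℕ→ℚ m * (seqProb μ y * (1ℚ - T y))) ≤⟨ sumL-mono-≤ S weighted ⟩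
    sumL S (λ y → seqProb μ y * ℕ→ℚ (offBaseCount y)) ≡⟨ expectation-additive (ℕ.suc n) q μ offBase Σμ≡1 ⟩
    ℕ→ℚ q * sumΩ (ℕ.suc n) (λ v → μ v * ℕ→ℚ (offBase v)) ≡⟨ cong (ℕ→ℚ q *_) (expected-offBase n μ Σμ≡1) ⟩
    ℕ→ℚ q * (1ℚ - μ zero)                           ∎
    where
    open ℚP.≤-Reasoning
    S = allSeqs (ℕ.suc n) q
    pointwise : ∀ y → ℕ→ℚ m * (1ℚ - T y) ≤ ℕ→ℚ (offBaseCount y)
    pointwise y with ℕ.suc (offBaseCount y) ℕ.≤? m
    ... | yes few = begin
      ℕ→ℚ m * (1ℚ - T y) ≡⟨ cong (λ t → ℕ→ℚ m * (1ℚ - t)) (accepts-few-offBase y few) ⟩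
      ℕ→ℚ m * (1ℚ - 1ℚ)  ≡⟨ cong (ℕ→ℚ m *_) (ℚP.+-inverseʳ 1ℚ) ⟩
      ℕ→ℚ m * 0ℚ         ≡⟨ ℚP.*-zeroʳ (ℕ→ℚ m) ⟩
      0ℚ                 ≤⟨ ℕ→ℚ-nonNeg (offBaseCount y) ⟩
      ℕ→ℚ (offBaseCount y) ∎
    ... | no many = ℚP.≤-trans (*-monoˡ-≤ (ℕ→ℚ-nonNeg m) (0≤p⇒1-p≤1 (proj₁ (proj₁ test y))))
                      (ℚP.≤-trans (ℚP.≤-reflexive (ℚP.*-identityʳ (ℕ→ℚ m))) (ℕ→ℚ-mono-≤ (ℕP.≮⇒≥ many)))
    weighted : ∀ y → ℕ→ℚ m * (seqProb μ y * (1ℚ - T y)) ≤ seqProb μ y * ℕ→ℚ (offBaseCount y)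
    weighted y = ℚP.≤-trans
      (ℚP.≤-reflexive (solve 3 (λ a p r → a :* (p :* r) := p :* (a :* r)) refl (ℕ→ℚ m) (seqProb μ y) (1ℚ - T y)))
      (*-monoˡ-≤ (seqProb-nonNeg 0≤μ y) (pointwise y))

massOffSupport≤dist : ∀ n (μ ν : Fin n → ℚ) → sumΩ n μ ≡ sumΩ n ν →
  sumΩ n (λ u → if inSupport ν u then 0ℚ else μ u) ≤ dist n μ ν
-- Since Σμ = Σν the terms ν u - μ u add up to 0, leaving 2Z ≤ Σ ∣μ - ν∣.
massOffSupport≤dist n μ ν Σμ≡Σν = begin
  Z                                             ≡⟨ solve 2 (λ s z → z := con ½ :* ((s :- s) :+ (z :+ z))) refl (sumΩ n μ) Z ⟩
  ½ * ((sumΩ n μ - sumΩ n μ) + (Z + Z))         ≡⟨ cong (λ s → ½ * ((s - sumΩ n μ) + (Z + Z))) Σμ≡Σν ⟩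
  ½ * ((sumΩ n ν - sumΩ n μ) + (Z + Z))         ≡⟨ cong (½ *_) (sym sum-split) ⟩
  ½ * sumΩ n (λ u → (ν u - μ u) + (z u + z u))  ≤⟨ *-monoˡ-≤ (ℚP.nonNegative⁻¹ ½) (sumL-mono-≤ (allFin n) pointwise) ⟩
  dist n μ ν                                    ∎
  where
  open ℚP.≤-Reasoning
  z : Fin n → ℚ
  z u = if inSupport ν u then 0ℚ else μ u
  Z = sumΩ n z
  sum-split : sumΩ n (λ u → (ν u - μ u) + (z u + z u)) ≡ (sumΩ n ν - sumΩ n μ) + (Z + Z)
  sum-split = trans (sumL-+ (allFin n) (λ u → ν u - μ u) (λ u → z u + z u))
                    (cong₂ _+_ (sumL-- (allFin n) ν μ) (sumL-+ (allFin n) z z))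
  pointwise : ∀ u → (ν u - μ u) + (z u + z u) ≤ ∣ μ u - ν u ∣
  pointwise u with ν u ℚP.≟ 0ℚ
  ... | yes νu≡0 rewrite νu≡0 =
    subst (_≤ ∣ μ u - 0ℚ ∣) (solve 1 (λ p → p :- con 0ℚ := (con 0ℚ :- p) :+ (p :+ p)) refl (μ u)) (p≤∣p∣ (μ u - 0ℚ))
  ... | no _ =
    subst₂ _≤_ (solve 2 (λ p r → :- (p :- r) := (r :- p) :+ (con 0ℚ :+ con 0ℚ)) refl (μ u) (ν u))
               (ℚP.∣-p∣≡∣p∣ (μ u - ν u)) (p≤∣p∣ (- (μ u - ν u)))

module HardInstance (m n : ℕ) .{{_ : ℕ.NonZero m}} (ε : ℚ) where

  1/m : ℚ
  1/m = 1/ fromℕ m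

  light : ℚ
  light = (ε + ε) * 1/m

  hard : Fin (ℕ.suc n) → ℚ
  hard zero    = 1ℚ - ((ε + ε) + (ε + ε))
  hard (suc u) = if F.toℕ u <ᵇ m ℕ.+ m then light else 0ℚ

  m*light : ℕ→ℚ m * light ≡ ε + ε
  m*light = begin
    ℕ→ℚ m * light                      ≡⟨ cong (_* light) (ℕ→ℚ≡fromℕ m) ⟩
    fromℕ m * ((ε + ε) * 1/m)          ≡⟨ solve 3 (λ k e i → k :* ((e :+ e) :* i) := (e :+ e) :* (k :* i)) refl (fromℕ m) ε 1/m ⟩
    (ε + ε) * (fromℕ m * 1/m)          ≡⟨ cong ((ε + ε) *_) (ℚP.*-inverseʳ (fromℕ m)) ⟩
    (ε + ε) * 1ℚ                       ≡⟨ ℚP.*-identityʳ (ε + ε) ⟩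
    ε + ε                              ∎
    where open ≡-Reasoning

  module _ (0<ε : 0ℚ < ε) (4ε≤1 : (ε + ε) + (ε + ε) ≤ 1ℚ) (2m≤n : m ℕ.+ m ℕ.≤ n) where

    light-nonNeg : 0ℚ ≤ light
    light-nonNeg = ℚP.<⇒≤ (pos*pos (ℚP.+-mono-< 0<ε 0<ε) (ℚP.positive⁻¹ 1/m {{ℚP.1/pos⇒pos (fromℕ m) {{ℚP.nonNeg∧nonZero⇒pos (fromℕ m)}}}}))

    hard-isDistribution : IsDistribution (ℕ.suc n) hard
    hard-isDistribution = nonNeg , mass
      where
      nonNeg : ∀ u → 0ℚ ≤ hard u
      nonNeg zero    = p≤q⇒0≤q-p 4ε≤1
      nonNeg (suc u) = if-nonNeg (F.toℕ u <ᵇ m ℕ.+ m) {light} light-nonNeg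
      mass : sumΩ (ℕ.suc n) hard ≡ 1ℚ
      mass = begin
        sumΩ (ℕ.suc n) hard                          ≡⟨ sumΩ-suc n hard ⟩
        hard zero + sumΩ n (hard ∘ suc)              ≡⟨ cong (hard zero +_) (sumL-if (λ u → F.toℕ u <ᵇ m ℕ.+ m) light (allFin n)) ⟩
        hard zero + ℕ→ℚ (count (λ u → F.toℕ u <ᵇ m ℕ.+ m) (allFin n)) * light
                                                     ≡⟨ cong (λ k → hard zero + ℕ→ℚ k * light) (count-<ᵇ 2m≤n) ⟩
        hard zero + ℕ→ℚ (m ℕ.+ m) * light            ≡⟨ cong (λ k → hard zero + k * light) (ℕ→ℚ-+ m m) ⟩
        hard zero + (ℕ→ℚ m + ℕ→ℚ m) * light          ≡⟨ cong (hard zero +_) (trans (ℚP.*-distribʳ-+ light (ℕ→ℚ m) (ℕ→ℚ m)) (cong₂ _+_ m*light m*light)) ⟩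
        hard zero + ((ε + ε) + (ε + ε))              ≡⟨ solve 1 (λ e → (con 1ℚ :- ((e :+ e) :+ (e :+ e))) :+ ((e :+ e) :+ (e :+ e)) := con 1ℚ) refl ε ⟩
        1ℚ                                           ∎
        where open ≡-Reasoning

    massOnSupport≤ : ∀ ν → InS m (ℕ.suc n) ν →
      sumΩ (ℕ.suc n) (λ u → if inSupport ν u then hard u else 0ℚ) ≤ hard zero + (ε + ε)
    massOnSupport≤ ν (_ , support≤m) = begin
      sumΩ (ℕ.suc n) (λ u → if D u then hard u else 0ℚ)                   ≡⟨ sumΩ-suc n (λ u → if D u then hard u else 0ℚ) ⟩
      (if D zero then hard zero else 0ℚ) + sumΩ n (λ u → if D (suc u) then hard (suc u) else 0ℚ)
        ≤⟨ ℚP.+-mono-≤ (if-≤ (D zero) (proj₁ hard-isDistribution zero))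
                       (sumL-mono-≤ (allFin n) (λ u → if-mono-≤ (D (suc u)) (if-≤ (F.toℕ u <ᵇ m ℕ.+ m) light-nonNeg))) ⟩
      hard zero + sumΩ n (λ u → if D (suc u) then light else 0ℚ)          ≡⟨ cong (hard zero +_) (sumL-if (D ∘ suc) light (allFin n)) ⟩
      hard zero + ℕ→ℚ (count (D ∘ suc) (allFin n)) * light               ≤⟨ ℚP.+-monoʳ-≤ (hard zero) (ℚP.*-monoʳ-≤-nonNeg light {{ℚ.nonNegative light-nonNeg}} (ℕ→ℚ-mono-≤ off-zero≤m)) ⟩
      hard zero + ℕ→ℚ m * light                                          ≡⟨ cong (hard zero +_) m*light ⟩
      hard zero + (ε + ε)                                                ∎
      where
      open ℚP.≤-Reasoning
      D = inSupport ν
      off-zero≤m : count (D ∘ suc) (allFin n) ℕ.≤ m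
      off-zero≤m = ℕP.≤-trans (count-∘suc≤ n D) (subst (ℕ._≤ m) (supportSize≡count (ℕ.suc n) ν) support≤m)

    hard-far : FarFromS m (ℕ.suc n) ε hard
    hard-far ν ν∈S = begin-strict
      ε                  <⟨ subst (_< ε + ε) (ℚP.+-identityʳ ε) (ℚP.+-monoʳ-< ε 0<ε) ⟩
      ε + ε              ≡⟨ solve 1 (λ e → e :+ e := con 1ℚ :- ((con 1ℚ :- ((e :+ e) :+ (e :+ e))) :+ (e :+ e))) refl ε ⟩
      1ℚ - (hard zero + (ε + ε)) ≤⟨ ℚP.+-monoʳ-≤ 1ℚ (ℚP.neg-antimono-≤ (massOnSupport≤ ν ν∈S)) ⟩
      1ℚ - on            ≡⟨ cong (_- on) (trans (sym (proj₂ hard-isDistribution)) (sym (sumL-if-split D hard (allFin (ℕ.suc n))))) ⟩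
      (off + on) - on    ≡⟨ solve 2 (λ a b → (a :+ b) :- b := a) refl off on ⟩
      off                ≤⟨ massOffSupport≤dist (ℕ.suc n) hard ν (trans (proj₂ hard-isDistribution) (sym (proj₂ (proj₁ ν∈S)))) ⟩
      dist (ℕ.suc n) hard ν ∎
      where
      open ℚP.≤-Reasoning
      D = inSupport ν
      on off : ℚ
      on  = sumΩ (ℕ.suc n) (λ u → if D u then hard u else 0ℚ)
      off = sumΩ (ℕ.suc n) (λ u → if D u then 0ℚ else hard u)

proposition4p5 : Σ ℚ λ c → Σ ℚ λ ε₀ → (0ℚ < c) × (0ℚ < ε₀) ×
    ((m : ℕ) → 1 ℕ.≤ m → (ε : ℚ) → 0ℚ < ε → ε < ε₀ →
     (n : ℕ) → 2 ℕ.* m ℕ.+ 1 ℕ.≤ n →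
     (q : ℕ) → (T : Vec (Fin n) q → ℚ) → IsOneSidedTest m n ε q T →
     c * ℕ→ℚ m ℚ.≤ ℕ→ℚ q * ε)
proposition4p5 = ⅙ , ¼ , ℚP.positive⁻¹ ⅙ , ℚP.positive⁻¹ ¼ , bound
  where
  ⅙ ¼ ⅔ : ℚ
  ⅙ = ℤ.+ 1 ℚ./ 6
  ¼ = ℤ.+ 1 ℚ./ 4
  ⅔ = ℤ.+ 2 ℚ./ 3
  bound : (m : ℕ) → 1 ℕ.≤ m → (ε : ℚ) → 0ℚ < ε → ε < ¼ →
    (n : ℕ) → 2 ℕ.* m ℕ.+ 1 ℕ.≤ n →
    (q : ℕ) → (T : Vec (Fin n) q → ℚ) → IsOneSidedTest m n ε q T →
    ⅙ * ℕ→ℚ m ≤ ℕ→ℚ q * ε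
  bound m@(ℕ.suc _) _ ε 0<ε ε<¼ (ℕ.suc n) 2m+1≤n q T test = begin
    ⅙ * ℕ→ℚ m                      ≡⟨ solve 1 (λ k → con ⅙ :* k := con ¼ :* (k :* con ⅔)) refl (ℕ→ℚ m) ⟩
    ¼ * (ℕ→ℚ m * ⅔)                ≤⟨ *-monoˡ-≤ (ℚP.nonNegative⁻¹ ¼) (ℚP.<⇒≤ m⅔<q4ε) ⟩
    ¼ * (ℕ→ℚ q * (1ℚ - hard zero)) ≡⟨ solve 2 (λ k e → con ¼ :* (k :* (con 1ℚ :- (con 1ℚ :- ((e :+ e) :+ (e :+ e))))) := k :* e) refl (ℕ→ℚ q) ε ⟩
    ℕ→ℚ q * ε                      ∎
    where
    open ℚP.≤-Reasoning
    open HardInstance m n ε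
    4ε≤1 : (ε + ε) + (ε + ε) ≤ 1ℚ
    4ε≤1 = ℚP.<⇒≤ (ℚP.+-mono-< (ℚP.+-mono-< ε<¼ ε<¼) (ℚP.+-mono-< ε<¼ ε<¼))
    2m≤n : m ℕ.+ m ℕ.≤ n
    2m≤n = ℕP.≤-pred (subst (ℕ._≤ ℕ.suc n) (trans (ℕP.+-comm (2 ℕ.* m) 1) (cong (λ k → ℕ.suc (m ℕ.+ k)) (ℕP.+-identityʳ m))) 2m+1≤n)
    hard-dist = hard-isDistribution 0<ε 4ε≤1 2m≤n
    m⅔<q4ε : ℕ→ℚ m * ⅔ < ℕ→ℚ q * (1ℚ - hard zero)
    m⅔<q4ε = ℚP.<-≤-trans
      (ℚP.*-monoʳ-<-pos (ℕ→ℚ m) {{subst ℚ.Positive (sym (ℕ→ℚ≡fromℕ m)) _}} (proj₂ (proj₂ test) hard hard-dist (hard-far 0<ε 4ε≤1 2m≤n)))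
      (rejection-bound test hard hard-dist)
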